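{- Let $k\ge1$, $n\ge2$, $m=kn+1$, $n'=n-1$, $m'=kn'+1$, and $D'\in\mathcal D_{m',n'}$. Suppose $\Phi^{ -1}(D')$ is cut at a vertex (other than its endpoint) of rank $r<m'$ (rank in the $(m',n')$ system) as $\Phi^{ -1}(D')=AB$, and let $D\in\mathcal D_{m,n}$ be defined by $\Phi^{ -1}(D)=N\,B\,A\,E^k$ (a North step, then $B$, then $A$, then $k$ East steps). Then $\mathrm{cobounce}(D)=\mathrm{cobounce}(D')+r$; equivalently, $\mathrm{bounce}(D)=\mathrm{bounce}(D')+n'k-r$.
   Context: For coprime $m,n$, $\mathcal D_{m,n}$ is the set of lattice paths from $(0,0)$ to $(m,n)$ with unit North and East steps staying weakly above the segment from $(0,0)$ to $(m,n)$. The rank of $(x,y)$ is $ym-xn$. The sweep map $\Phi:\mathcal D_{m,n}\to\mathcal D_{m,n}$ sends $P$ to the path whose $i$-th step is North iff the step of $P$ with the $i$-th smallest starting rank is North; it is a bijection when $m=kn+1$ (and the path $NBAE^k$ above lies in $\mathcal D_{m,n}$). $\mathrm{area}(P)$ is the number of unit cells between $P$ and the main diagonal not cut by the diagonal. $\mathrm{bounce}(D):=\mathrm{area}(\Phi^{ -1}(D))$, and for $D\in\mathcal D_{kn+1,n}$, $\mathrm{cobounce}(D):=k\binom n2-\mathrm{bounce}(D)$ (similarly with $n'$ for $D'$). -}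

module Defs where

open import Data.Nat using (ℕ; zero; suc; _+_; _*_; _≤ᵇ_)
open import Data.Integer as ℤ using (ℤ; +_; _-_)
open import Data.Bool using (Bool; true; false; if_then_else_)
open import Data.List using (List; []; _∷_; map; length; filter)
open import Data.List.Relation.Unary.All using (All)
open import Data.Product using (_×_; _,_; proj₁; proj₂)
open import Relation.Binary.PropositionalEquality using (_≡_)

data Step : Set where
  N E : Step

Path : Set
Path = List Step

#E : Path → ℕ
#E []       = 0
#E (N ∷ p)  = #E p
#E (E ∷ p)  = suc (#E p)

#N : Path → ℕ
#N []       = 0
#N (N ∷ p)  = suc (#N p)
#N (E ∷ p)  = #N p

endpoint : Path → ℕ × ℕ
endpoint p = (#E p , #N p)

rank : ℕ → ℕ → ℕ × ℕ → ℤ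
rank m n (x , y) = + (y * m) - + (x * n)

stepsFrom : ℕ × ℕ → Path → List ((ℕ × ℕ) × Step)
stepsFrom v []                = []
stepsFrom (x , y) (N ∷ p)     = ((x , y) , N) ∷ stepsFrom (x , suc y) p
stepsFrom (x , y) (E ∷ p)     = ((x , y) , E) ∷ stepsFrom (suc x , y) p

steps : Path → List ((ℕ × ℕ) × Step)
steps = stepsFrom (0 , 0)

-- P ∈ 𝒟_{m,n}: from (0,0) to (m,n), every vertex weakly above the diagonal
-- (rank ≥ 0); the endpoint has rank 0, so checking starting vertices suffices.
InD : ℕ → ℕ → Path → Set
InD m n P = (#E P ≡ m) × (#N P ≡ n)
          × All (λ s → ℤ.0ℤ ℤ.≤ (rank m n (proj₁ s))) (steps P)

insertBy : List (ℤ × Step) → ℤ × Step → List (ℤ × Step)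
insertBy [] a = a ∷ []
insertBy (b ∷ bs) a =
  if proj₁ a ℤ.≤ᵇ proj₁ b then a ∷ b ∷ bs else b ∷ insertBy bs a

sortByRank : List (ℤ × Step) → List (ℤ × Step)
sortByRank []       = []
sortByRank (a ∷ as) = insertBy (sortByRank as) a

-- Sweep map Φ: the i-th step of Φ(P) is the step of P with the i-th
-- smallest starting rank (starting ranks are distinct for coprime m,n).
sweep : ℕ → ℕ → Path → Path
sweep m n P =
  map proj₂ (sortByRank (map (λ s → (rank m n (proj₁ s) , proj₂ s)) (steps P)))

countFrom : (ℕ → Bool) → ℕ → ℕ → ℕ
countFrom t x zero    = 0
countFrom t x (suc k) = (if t x then 1 else 0) + countFrom t (suc x) k

-- cells in row y (between heights y and y+1) with lower-left corner (j,y),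
-- x ≤ j < m, lying entirely weakly above the diagonal, i.e. whose
-- lower-right corner (j+1,y) has rank ≥ 0:  (j+1)*n ≤ y*m.
rowCells : ℕ → ℕ → ℕ → ℕ → ℕ
rowCells m n x y = countFrom (λ j → (suc j * n) ≤ᵇ (y * m)) x (m Data.Nat.∸ x)

-- area(P): full cells between P and the diagonal (not cut by it): for each
-- North step starting at (x,y), the full cells of row y to its right.
areaSteps : ℕ → ℕ → List ((ℕ × ℕ) × Step) → ℕ
areaSteps m n []                    = 0
areaSteps m n (((x , y) , N) ∷ ss)  = rowCells m n x y + areaSteps m n ss
areaSteps m n (((x , y) , E) ∷ ss)  = areaSteps m n ss

area : ℕ → ℕ → Path → ℕ
area m n P = areaSteps m n (steps P)

Ek : ℕ → Path
Ek zero    = []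
Ek (suc k) = E ∷ Ek k

-- For m = kn + 1 and a North step in a row y < n, the row condition (x+1)n ≤ ym
-- is equivalent to x < yk, so a North step starting at (x , y) contributes
-- exactly yk − x cells to the area and the area becomes a linear functional of
-- the path.  Translating a piece of a path by a vector then changes its area by
-- its number of North steps times the induced change of yk − x, and moving A
-- after B (with an extra N in front and E^k at the end) changes the area by
-- kn' − r, where r = (#N A)(#E B) − (#E A)(#N B) is the rank of the cut point.
-- The rank bound r < m' is precisely what keeps the rearranged path valid.
module Submission where

open import Defs
open import Data.Bool using (Bool; true; false; T; if_then_else_)
open import Data.Integer as ℤ using (ℤ; +_; _-_)
import Data.Integer.Properties as ℤ
import Data.Integer.Tactic.RingSolver as ℤ-Ring
open import Data.List using (List; []; _∷_; _++_)
open import Data.List.Relation.Unary.All as All using (All; []; _∷_)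
open import Data.List.Relation.Unary.All.Properties using (++⁺; ++⁻ˡ; ++⁻ʳ)
open import Data.Nat using (ℕ; zero; suc; _+_; _*_; _∸_; _≤_; _<_; z≤n; s≤s; _≤ᵇ_)
import Data.Nat.Properties as ℕ
import Data.Nat.Tactic.RingSolver as ℕ-Ring
open import Data.Nat.Combinatorics using (_C_; nCk+nC[k+1]≡[n+1]C[k+1]; nC1≡n)
open import Data.Product using (_×_; _,_; proj₁)
open import Data.Unit using (⊤; tt)
open import Function using (_⇔_; mk⇔; Equivalence)
open import Relation.Binary.PropositionalEquality

#E-++ : ∀ A B → #E (A ++ B) ≡ #E A + #E B
#E-++ []      B = refl
#E-++ (N ∷ A) B = #E-++ A B
#E-++ (E ∷ A) B = cong suc (#E-++ A B)

#N-++ : ∀ A B → #N (A ++ B) ≡ #N A + #N B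
#N-++ []      B = refl
#N-++ (N ∷ A) B = cong suc (#N-++ A B)
#N-++ (E ∷ A) B = #N-++ A B

#N-Ek : ∀ j → #N (Ek j) ≡ 0
#N-Ek zero    = refl
#N-Ek (suc j) = #N-Ek j

stepsFrom-++ : ∀ x y A B →
  stepsFrom (x , y) (A ++ B) ≡ stepsFrom (x , y) A ++ stepsFrom (x + #E A , y + #N A) B
stepsFrom-++ x y []      B rewrite ℕ.+-identityʳ x | ℕ.+-identityʳ y = refl
stepsFrom-++ x y (N ∷ A) B rewrite ℕ.+-suc y (#N A) = cong (((x , y) , N) ∷_) (stepsFrom-++ x (suc y) A B)
stepsFrom-++ x y (E ∷ A) B rewrite ℕ.+-suc x (#E A) = cong (((x , y) , E) ∷_) (stepsFrom-++ (suc x) y A B)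

module _ {P : (ℕ × ℕ) × Step → Set} (x y : ℕ) (A B : Path) where

  All-stepsFrom-++⁺ : All P (stepsFrom (x , y) A) → All P (stepsFrom (x + #E A , y + #N A) B) →
                      All P (stepsFrom (x , y) (A ++ B))
  All-stepsFrom-++⁺ pa pb = subst (All P) (sym (stepsFrom-++ x y A B)) (++⁺ pa pb)

  All-stepsFrom-++⁻ˡ : All P (stepsFrom (x , y) (A ++ B)) → All P (stepsFrom (x , y) A)
  All-stepsFrom-++⁻ˡ pab = ++⁻ˡ _ (subst (All P) (stepsFrom-++ x y A B) pab)

  All-stepsFrom-++⁻ʳ : All P (stepsFrom (x , y) (A ++ B)) → All P (stepsFrom (x + #E A , y + #N A) B)
  All-stepsFrom-++⁻ʳ pab = ++⁻ʳ (stepsFrom (x , y) A) (subst (All P) (stepsFrom-++ x y A B) pab)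

OnNorth : (ℕ × ℕ → Set) → (ℕ × ℕ) × Step → Set
OnNorth P (v , N) = P v
OnNorth P (v , E) = ⊤

BelowRow : ℕ → ℕ × ℕ → Set
BelowRow n (x , y) = y < n

AboveLine : ℕ → ℕ × ℕ → Set
AboveLine k (x , y) = x ≤ y * k

onNorth-Ek : ∀ {P} j x y → All (OnNorth P) (stepsFrom (x , y) (Ek j))
onNorth-Ek zero    x y = []
onNorth-Ek (suc j) x y = tt ∷ onNorth-Ek j (suc x) y

belowRow-stepsFrom : ∀ n x y p → y + #N p ≤ n → All (OnNorth (BelowRow n)) (stepsFrom (x , y) p)
belowRow-stepsFrom n x y []      _ = []
belowRow-stepsFrom n x y (N ∷ p) le =
  ℕ.≤-trans (s≤s (ℕ.m≤m+n y (#N p))) le′ ∷ belowRow-stepsFrom n x (suc y) p le′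
  where
  le′ : suc y + #N p ≤ n
  le′ = subst (_≤ n) (ℕ.+-suc y (#N p)) le
belowRow-stepsFrom n x y (E ∷ p) le = tt ∷ belowRow-stepsFrom n (suc x) y p le

aboveLine-translate : ∀ k p {x y x₀ y₀} → x + y₀ * k ≤ x₀ + y * k →
  All (OnNorth (AboveLine k)) (stepsFrom (x₀ , y₀) p) → All (OnNorth (AboveLine k)) (stepsFrom (x , y) p)
aboveLine-translate k []      _ _ = []
aboveLine-translate k (N ∷ p) {x} {y} {x₀} {y₀} h (x₀≤ ∷ rest) =
  ℕ.+-cancelʳ-≤ (y₀ * k) x (y * k) x≤ ∷ aboveLine-translate k p h′ rest
  where
  open ℕ.≤-Reasoning
  x≤ : x + y₀ * k ≤ y * k + y₀ * k
  x≤ = begin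
    x + y₀ * k   ≤⟨ h ⟩
    x₀ + y * k   ≤⟨ ℕ.+-monoˡ-≤ (y * k) x₀≤ ⟩
    y₀ * k + y * k ≡⟨ ℕ.+-comm (y₀ * k) (y * k) ⟩
    y * k + y₀ * k ∎
  swap : ∀ a b c → a + (b + c) ≡ b + (a + c)
  swap = ℕ-Ring.solve-∀
  h′ : x + suc y₀ * k ≤ x₀ + suc y * k
  h′ = subst₂ _≤_ (swap k x (y₀ * k)) (swap k x₀ (y * k)) (ℕ.+-monoʳ-≤ k h)
aboveLine-translate k (E ∷ p) h (_ ∷ rest) = tt ∷ aboveLine-translate k p (s≤s h) rest

y*[kn+1]≡ykn+y : ∀ y k n → y * (k * n + 1) ≡ y * k * n + y
y*[kn+1]≡ykn+y = ℕ-Ring.solve-∀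

xn≤y[kn+1]⇔x≤yk : ∀ k {n x y} → y < n → (x * n ≤ y * (k * n + 1) ⇔ x ≤ y * k)
xn≤y[kn+1]⇔x≤yk k {n} {x} {y} y<n = mk⇔ to from
  where
  expand : y * (k * n + 1) ≡ y * k * n + y
  expand = y*[kn+1]≡ykn+y y k n
  below-next : y * (k * n + 1) < suc (y * k) * n
  below-next = subst₂ _<_ (sym expand) (ℕ.+-comm (y * k * n) n) (ℕ.+-monoʳ-< (y * k * n) y<n)
  to : x * n ≤ y * (k * n + 1) → x ≤ y * k
  to h = ℕ.≤-pred (ℕ.*-cancelʳ-< n x (suc (y * k)) (ℕ.≤-<-trans h below-next))
  from : x ≤ y * k → x * n ≤ y * (k * n + 1)
  from h = ℕ.≤-trans (ℕ.*-monoˡ-≤ n h) (subst (y * k * n ≤_) (sym expand) (ℕ.m≤m+n _ y))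

countFrom-below : ∀ (t : ℕ → Bool) K → (∀ j → T (t j) ⇔ j < K) →
                  ∀ x c → K ≤ x + c → countFrom t x c ≡ K ∸ x
countFrom-below t K t⇔ x zero K≤x = sym (ℕ.m≤n⇒m∸n≡0 (subst (K ≤_) (ℕ.+-identityʳ x) K≤x))
countFrom-below t K t⇔ x (suc c) K≤ =
  step (countFrom-below t K t⇔ (suc x) c (subst (K ≤_) (ℕ.+-suc x c) K≤))
  where
  step : countFrom t (suc x) c ≡ K ∸ suc x → (if t x then 1 else 0) + countFrom t (suc x) c ≡ K ∸ x
  step rec with t x in tx
  ... | true  = trans (cong suc rec) (sym (ℕ.+-∸-assoc 1 (Equivalence.to (t⇔ x) (subst T (sym tx) tt))))
  ... | false = trans rec (trans (ℕ.m≤n⇒m∸n≡0 (ℕ.m≤n⇒m≤1+n K≤x)) (sym (ℕ.m≤n⇒m∸n≡0 K≤x)))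
    where
    K≤x : K ≤ x
    K≤x = ℕ.≮⇒≥ (λ x<K → subst T tx (Equivalence.from (t⇔ x) x<K))

rowCells-kn+1 : ∀ k n x y → y < n → rowCells (k * n + 1) n x y ≡ y * k ∸ x
rowCells-kn+1 k n x y y<n =
  countFrom-below _ (y * k) test x (k * n + 1 ∸ x)
    (ℕ.≤-trans yk≤m (ℕ.m≤n+m∸n (k * n + 1) x))
  where
  test : ∀ j → T (suc j * n ≤ᵇ y * (k * n + 1)) ⇔ j < y * k
  test j = mk⇔ (λ h → Equivalence.to (xn≤y[kn+1]⇔x≤yk k y<n) (ℕ.≤ᵇ⇒≤ _ _ h))
               (λ h → ℕ.≤⇒≤ᵇ (Equivalence.from (xn≤y[kn+1]⇔x≤yk k y<n) h))
  yk≤m : y * k ≤ k * n + 1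
  yk≤m = ℕ.≤-trans (ℕ.≤-trans (ℕ.*-monoˡ-≤ k (ℕ.<⇒≤ y<n)) (ℕ.≤-reflexive (ℕ.*-comm n k)))
                   (ℕ.m≤m+n (k * n) 1)

gap : ℕ → ℕ × ℕ → ℤ
gap k (x , y) = + y ℤ.* + k - + x

linearArea : ℕ → List ((ℕ × ℕ) × Step) → ℤ
linearArea k []             = ℤ.0ℤ
linearArea k ((v , N) ∷ ss) = gap k v ℤ.+ linearArea k ss
linearArea k ((v , E) ∷ ss) = linearArea k ss

gap-aboveLine : ∀ k x y → AboveLine k (x , y) → + (y * k ∸ x) ≡ gap k (x , y)
gap-aboveLine k x y x≤yk = begin
  + (y * k ∸ x)        ≡⟨ ℤ.⊖-≥ x≤yk ⟨
  (y * k) ℤ.⊖ x        ≡⟨ ℤ.m-n≡m⊖n (y * k) x ⟨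
  + (y * k) - + x      ≡⟨ cong (_- + x) (ℤ.pos-* y k) ⟩
  + y ℤ.* + k - + x    ∎
  where open ≡-Reasoning

areaSteps-kn+1 : ∀ k n ss → All (OnNorth (BelowRow n)) ss → All (OnNorth (AboveLine k)) ss →
                 + areaSteps (k * n + 1) n ss ≡ linearArea k ss
areaSteps-kn+1 k n []                   _          _          = refl
areaSteps-kn+1 k n (((x , y) , N) ∷ ss) (y<n ∷ rs) (x≤ ∷ as) =
  trans (ℤ.pos-+ (rowCells (k * n + 1) n x y) _)
        (cong₂ ℤ._+_ (trans (cong +_ (rowCells-kn+1 k n x y y<n)) (gap-aboveLine k x y x≤))
                     (areaSteps-kn+1 k n ss rs as))
areaSteps-kn+1 k n ((_ , E) ∷ ss)       (_ ∷ rs)   (_ ∷ as)   = areaSteps-kn+1 k n ss rs as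

area-kn+1 : ∀ k n p → #N p ≤ n → All (OnNorth (AboveLine k)) (steps p) →
            + area (k * n + 1) n p ≡ linearArea k (steps p)
area-kn+1 k n p #N≤n = areaSteps-kn+1 k n (steps p) (belowRow-stepsFrom n 0 0 p #N≤n)

aboveLine-rank : ∀ k n s → OnNorth (BelowRow n) s → ℤ.0ℤ ℤ.≤ rank (k * n + 1) n (proj₁ s) →
                 OnNorth (AboveLine k) s
aboveLine-rank k n ((x , y) , N) y<n 0≤r = Equivalence.to (xn≤y[kn+1]⇔x≤yk k y<n) (ℤ.drop‿+≤+ (ℤ.0≤i-j⇒j≤i 0≤r))
aboveLine-rank k n (_ , E)       _   _   = tt

aboveLine-InD : ∀ k n p → InD (k * n + 1) n p → All (OnNorth (AboveLine k)) (steps p)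
aboveLine-InD k n p (_ , #N≡ , ranks) =
  All.zipWith (λ { {s} (below , r≥0) → aboveLine-rank k n s below r≥0 })
              (belowRow-stepsFrom n 0 0 p (ℕ.≤-reflexive #N≡) , ranks)

linearArea-++ : ∀ k ss ts → linearArea k (ss ++ ts) ≡ linearArea k ss ℤ.+ linearArea k ts
linearArea-++ k []             ts = sym (ℤ.+-identityˡ _)
linearArea-++ k ((v , N) ∷ ss) ts =
  trans (cong (ℤ._+_ (gap k v)) (linearArea-++ k ss ts)) (sym (ℤ.+-assoc (gap k v) _ _))
linearArea-++ k ((v , E) ∷ ss) ts = linearArea-++ k ss ts

linearArea-Ek : ∀ k j x y → linearArea k (stepsFrom (x , y) (Ek j)) ≡ ℤ.0ℤ
linearArea-Ek k zero    x y = refl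
linearArea-Ek k (suc j) x y = linearArea-Ek k j (suc x) y

-- The ring identities are stated with + (suc y) written as ℤ.1ℤ ℤ.+ + y, to which it reduces.
linearArea-stepsFrom : ∀ k p x y →
  linearArea k (stepsFrom (x , y) p) ≡ linearArea k (steps p) ℤ.+ + #N p ℤ.* gap k (x , y)
linearArea-stepsFrom k []      x y = sym (ℤ.+-identityʳ ℤ.0ℤ)
linearArea-stepsFrom k (N ∷ p) x y = begin
  gap k (x , y) ℤ.+ linearArea k (stepsFrom (x , suc y) p)
    ≡⟨ cong (ℤ._+_ (gap k (x , y))) (linearArea-stepsFrom k p x (suc y)) ⟩
  gap k (x , y) ℤ.+ (L ℤ.+ #Np ℤ.* gap k (x , suc y))
    ≡⟨ shift-N L #Np (+ k) (+ x) (+ y) ⟩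
  (gap k (0 , 0) ℤ.+ (L ℤ.+ #Np ℤ.* gap k (0 , 1))) ℤ.+ (ℤ.1ℤ ℤ.+ #Np) ℤ.* gap k (x , y)
    ≡⟨ cong (λ z → (gap k (0 , 0) ℤ.+ z) ℤ.+ (ℤ.1ℤ ℤ.+ #Np) ℤ.* gap k (x , y)) (linearArea-stepsFrom k p 0 1) ⟨
  linearArea k (steps (N ∷ p)) ℤ.+ (ℤ.1ℤ ℤ.+ #Np) ℤ.* gap k (x , y) ∎
  where
  open ≡-Reasoning
  L #Np : ℤ
  L = linearArea k (steps p)
  #Np = + #N p
  shift-N : ∀ L c K X Y → (Y ℤ.* K - X) ℤ.+ (L ℤ.+ c ℤ.* ((ℤ.1ℤ ℤ.+ Y) ℤ.* K - X))
            ≡ (+ 0 ℤ.* K - + 0 ℤ.+ (L ℤ.+ c ℤ.* (ℤ.1ℤ ℤ.* K - + 0))) ℤ.+ (ℤ.1ℤ ℤ.+ c) ℤ.* (Y ℤ.* K - X)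
  shift-N = ℤ-Ring.solve-∀
linearArea-stepsFrom k (E ∷ p) x y = begin
  linearArea k (stepsFrom (suc x , y) p)
    ≡⟨ linearArea-stepsFrom k p (suc x) y ⟩
  L ℤ.+ #Np ℤ.* gap k (suc x , y)
    ≡⟨ shift-E L #Np (+ k) (+ x) (+ y) ⟩
  (L ℤ.+ #Np ℤ.* gap k (1 , 0)) ℤ.+ #Np ℤ.* gap k (x , y)
    ≡⟨ cong (ℤ._+ #Np ℤ.* gap k (x , y)) (linearArea-stepsFrom k p 1 0) ⟨
  linearArea k (steps (E ∷ p)) ℤ.+ #Np ℤ.* gap k (x , y) ∎
  where
  open ≡-Reasoning
  L #Np : ℤ
  L = linearArea k (steps p)
  #Np = + #N p
  shift-E : ∀ L c K X Y → L ℤ.+ c ℤ.* (Y ℤ.* K - (ℤ.1ℤ ℤ.+ X))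
            ≡ (L ℤ.+ c ℤ.* (+ 0 ℤ.* K - ℤ.1ℤ)) ℤ.+ c ℤ.* (Y ℤ.* K - X)
  shift-E = ℤ-Ring.solve-∀

linearArea-stepsFrom-++ : ∀ k x y A B → linearArea k (stepsFrom (x , y) (A ++ B))
  ≡ linearArea k (stepsFrom (x , y) A) ℤ.+ linearArea k (stepsFrom (x + #E A , y + #N A) B)
linearArea-stepsFrom-++ k x y A B =
  trans (cong (linearArea k) (stepsFrom-++ x y A B)) (linearArea-++ k (stepsFrom (x , y) A) _)

linearArea-rotate : ∀ k j A B →
  linearArea k (steps (N ∷ B ++ A ++ Ek j)) ℤ.+ (+ #N A ℤ.* + #E B - + #E A ℤ.* + #N B)
  ≡ linearArea k (steps (A ++ B)) ℤ.+ + k ℤ.* (+ #N A ℤ.+ + #N B)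
linearArea-rotate k j A B = begin
    gap k (0 , 0) ℤ.+ linearArea k (stepsFrom (0 , 1) (B ++ A ++ Ek j)) ℤ.+ cross
  ≡⟨ cong (λ z → gap k (0 , 0) ℤ.+ z ℤ.+ cross) rotated ⟩
    gap k (0 , 0) ℤ.+ (LB ℤ.+ NB ℤ.* gap k (0 , 1) ℤ.+ (LA ℤ.+ NA ℤ.* gap k (eB , suc nB) ℤ.+ ℤ.0ℤ))
      ℤ.+ cross
  ≡⟨ rearrange LA LB NA NB (+ a) (+ eB) (+ k) ⟩
    LA ℤ.+ (LB ℤ.+ NB ℤ.* gap k (a , b)) ℤ.+ + k ℤ.* (NA ℤ.+ NB)
  ≡⟨ cong (ℤ._+ + k ℤ.* (NA ℤ.+ NB)) original ⟨
    linearArea k (steps (A ++ B)) ℤ.+ + k ℤ.* (NA ℤ.+ NB) ∎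
  where
  open ≡-Reasoning
  a b eB nB : ℕ
  a = #E A
  b = #N A
  eB = #E B
  nB = #N B
  NA NB LA LB cross : ℤ
  NA = + b
  NB = + nB
  LA = linearArea k (steps A)
  LB = linearArea k (steps B)
  cross = NA ℤ.* + eB - + a ℤ.* NB
  rotated : linearArea k (stepsFrom (0 , 1) (B ++ A ++ Ek j))
            ≡ LB ℤ.+ NB ℤ.* gap k (0 , 1) ℤ.+ (LA ℤ.+ NA ℤ.* gap k (eB , suc nB) ℤ.+ ℤ.0ℤ)
  rotated = begin
    linearArea k (stepsFrom (0 , 1) (B ++ A ++ Ek j))
      ≡⟨ linearArea-stepsFrom-++ k 0 1 B (A ++ Ek j) ⟩
    linearArea k (stepsFrom (0 , 1) B) ℤ.+ linearArea k (stepsFrom (eB , suc nB) (A ++ Ek j))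
      ≡⟨ cong (ℤ._+_ (linearArea k (stepsFrom (0 , 1) B))) (linearArea-stepsFrom-++ k eB (suc nB) A (Ek j)) ⟩
    linearArea k (stepsFrom (0 , 1) B)
      ℤ.+ (linearArea k (stepsFrom (eB , suc nB) A) ℤ.+ linearArea k (stepsFrom (eB + a , suc nB + b) (Ek j)))
      ≡⟨ cong₂ ℤ._+_ (linearArea-stepsFrom k B 0 1)
                     (cong₂ ℤ._+_ (linearArea-stepsFrom k A eB (suc nB)) (linearArea-Ek k j (eB + a) (suc nB + b))) ⟩
    LB ℤ.+ NB ℤ.* gap k (0 , 1) ℤ.+ (LA ℤ.+ NA ℤ.* gap k (eB , suc nB) ℤ.+ ℤ.0ℤ) ∎
  original : linearArea k (steps (A ++ B)) ≡ LA ℤ.+ (LB ℤ.+ NB ℤ.* gap k (a , b))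
  original = trans (linearArea-stepsFrom-++ k 0 0 A B) (cong (ℤ._+_ LA) (linearArea-stepsFrom k B a b))
  rearrange : ∀ LA LB NA NB EA EB K →
    + 0 ℤ.* K - + 0 ℤ.+ (LB ℤ.+ NB ℤ.* (+ 1 ℤ.* K - + 0) ℤ.+ (LA ℤ.+ NA ℤ.* ((ℤ.1ℤ ℤ.+ NB) ℤ.* K - EB) ℤ.+ ℤ.0ℤ))
      ℤ.+ (NA ℤ.* EB - EA ℤ.* NB)
    ≡ LA ℤ.+ (LB ℤ.+ NB ℤ.* (NA ℤ.* K - EA)) ℤ.+ K ℤ.* (NA ℤ.+ NB)
  rearrange = ℤ-Ring.solve-∀

rank-cut : ∀ {m n} A B → #E A + #E B ≡ m → #N A + #N B ≡ n →
           rank m n (endpoint A) ≡ + #N A ℤ.* + #E B - + #E A ℤ.* + #N B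
rank-cut A B refl refl =
  trans (cong₂ _-_ (ℤ.pos-* (#N A) (#E A + #E B)) (ℤ.pos-* (#E A) (#N A + #N B)))
        (cancel (+ #E A) (+ #N A) (+ #E B) (+ #N B))
  where
  cancel : ∀ a b e n → b ℤ.* (a ℤ.+ e) - a ℤ.* (b ℤ.+ n) ≡ b ℤ.* e - a ℤ.* n
  cancel = ℤ-Ring.solve-∀

rank<m⇒bk<a+k : ∀ k n a b → 1 ≤ k → rank (k * n + 1) n (a , b) ℤ.< + (k * n + 1) → b * k < a + k
rank<m⇒bk<a+k k n a b k≥1 r<m = bound b (ℤ.drop‿+<+ below)
  where
  m : ℕ
  m = k * n + 1
  sub-add : ∀ x y → x ≡ x - y ℤ.+ y
  sub-add = ℤ-Ring.solve-∀
  below : + (b * m) ℤ.< + m ℤ.+ + (a * n)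
  below = subst (ℤ._< + m ℤ.+ + (a * n)) (sym (sub-add (+ (b * m)) (+ (a * n))))
                (ℤ.+-monoˡ-< (+ (a * n)) r<m)
  bound : ∀ b → b * m < m + a * n → b * k < a + k
  bound zero    _  = ℕ.≤-trans k≥1 (ℕ.m≤n+m k a)
  bound (suc c) lt = subst (k + c * k <_) (ℕ.+-comm k a) (ℕ.+-monoʳ-< k ck<a)
    where
    cm<an : c * m < a * n
    cm<an = ℕ.+-cancelˡ-< m (c * m) (a * n) lt
    ck<a : c * k < a
    ck<a = ℕ.*-cancelʳ-< n (c * k) a
             (ℕ.≤-<-trans (subst (c * k * n ≤_) (sym (y*[kn+1]≡ykn+y c k n)) (ℕ.m≤m+n _ c)) cm<an)

#N-rotate : ∀ j A B → #N (N ∷ B ++ A ++ Ek j) ≡ suc (#N (A ++ B))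
#N-rotate j A B = cong suc (begin
  #N (B ++ A ++ Ek j)     ≡⟨ #N-++ B (A ++ Ek j) ⟩
  #N B + #N (A ++ Ek j)   ≡⟨ cong (_+_ (#N B)) (#N-++ A (Ek j)) ⟩
  #N B + (#N A + #N (Ek j)) ≡⟨ cong (λ z → #N B + (#N A + z)) (#N-Ek j) ⟩
  #N B + (#N A + 0)       ≡⟨ cong (_+_ (#N B)) (ℕ.+-identityʳ (#N A)) ⟩
  #N B + #N A             ≡⟨ ℕ.+-comm (#N B) (#N A) ⟩
  #N A + #N B             ≡⟨ #N-++ A B ⟨
  #N (A ++ B)             ∎)
  where open ≡-Reasoning

aboveLine-rotate : ∀ k j A B → #N A * k < #E A + k → #E A + #E B ≡ k * (#N A + #N B) + 1 →
  All (OnNorth (AboveLine k)) (steps (A ++ B)) → All (OnNorth (AboveLine k)) (steps (N ∷ B ++ A ++ Ek j))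
aboveLine-rotate k j A B bk<a+k #E≡ above =
  z≤n ∷ All-stepsFrom-++⁺ 0 1 B (A ++ Ek j)
          (aboveLine-translate k B B-fits (All-stepsFrom-++⁻ʳ 0 0 A B above))
          (All-stepsFrom-++⁺ (#E B) (suc (#N B)) A (Ek j)
             (aboveLine-translate k A A-fits (All-stepsFrom-++⁻ˡ 0 0 A B above))
             (onNorth-Ek j _ _))
  where
  a b eB nB : ℕ
  a = #E A
  b = #N A
  eB = #E B
  nB = #N B
  B-fits : b * k ≤ a + 1 * k
  B-fits = subst (λ z → b * k ≤ a + z) (sym (ℕ.*-identityˡ k)) (ℕ.<⇒≤ bk<a+k)
  regroup : ∀ eB a k → eB + (a + k) ≡ a + eB + k
  regroup = ℕ-Ring.solve-∀
  expand : ∀ k b nB → k * (b + nB) + 1 + k ≡ k + nB * k + suc (b * k)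
  expand = ℕ-Ring.solve-∀
  eB≤ : eB ≤ k + nB * k
  eB≤ = ℕ.+-cancelʳ-≤ (suc (b * k)) eB (k + nB * k) (begin
    eB + suc (b * k)           ≤⟨ ℕ.+-monoʳ-≤ eB bk<a+k ⟩
    eB + (a + k)               ≡⟨ regroup eB a k ⟩
    a + eB + k                 ≡⟨ cong (_+ k) #E≡ ⟩
    k * (b + nB) + 1 + k       ≡⟨ expand k b nB ⟩
    k + nB * k + suc (b * k)   ∎)
    where open ℕ.≤-Reasoning
  A-fits : eB + 0 * k ≤ 0 + suc nB * k
  A-fits = subst (_≤ k + nB * k) (sym (ℕ.+-identityʳ eB)) eB≤

k*[1+n]C2 : ∀ k n → k * (suc n C 2) ≡ k * (n C 2) + k * n
k*[1+n]C2 k n = begin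
  k * (suc n C 2)       ≡⟨ cong (k *_) (nCk+nC[k+1]≡[n+1]C[k+1] n 1) ⟨
  k * (n C 1 + n C 2)   ≡⟨ cong (λ z → k * (z + n C 2)) (nC1≡n n) ⟩
  k * (n + n C 2)       ≡⟨ ℕ.*-distribˡ-+ k n (n C 2) ⟩
  k * n + k * (n C 2)   ≡⟨ ℕ.+-comm (k * n) (k * (n C 2)) ⟩
  k * (n C 2) + k * n   ∎
  where open ≡-Reasoning

[c+s]-x≡[c-y]+r : ∀ c s X Y r → X ℤ.+ r ≡ Y ℤ.+ s → c ℤ.+ s - X ≡ c - Y ℤ.+ r
[c+s]-x≡[c-y]+r c s X Y r eq = begin
  c ℤ.+ s - X                    ≡⟨ add-sub c s X r ⟩
  c ℤ.+ s - (X ℤ.+ r) ℤ.+ r      ≡⟨ cong (λ z → c ℤ.+ s - z ℤ.+ r) eq ⟩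
  c ℤ.+ s - (Y ℤ.+ s) ℤ.+ r      ≡⟨ cancel c s Y r ⟩
  c - Y ℤ.+ r                    ∎
  where
  open ≡-Reasoning
  add-sub : ∀ c s X r → c ℤ.+ s - X ≡ c ℤ.+ s - (X ℤ.+ r) ℤ.+ r
  add-sub = ℤ-Ring.solve-∀
  cancel : ∀ c s Y r → c ℤ.+ s - (Y ℤ.+ s) ℤ.+ r ≡ c - Y ℤ.+ r
  cancel = ℤ-Ring.solve-∀

theorem4p8 : (k n : ℕ) → 1 ≤ k → 2 ≤ n →
    (D' D A B : Path) (r : ℤ) →
    InD (k * (n ∸ 1) + 1) (n ∸ 1) D' →
    InD (k * (n ∸ 1) + 1) (n ∸ 1) (A ++ B) →
    sweep (k * (n ∸ 1) + 1) (n ∸ 1) (A ++ B) ≡ D' →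
    B ≢ [] →
    rank (k * (n ∸ 1) + 1) (n ∸ 1) (endpoint A) ≡ r →
    r ℤ.< + (k * (n ∸ 1) + 1) →
    sweep (k * n + 1) n (N ∷ B ++ A ++ Ek k) ≡ D →
    (+ (k * (n C 2)) - + area (k * n + 1) n (N ∷ B ++ A ++ Ek k))
      ≡ (+ (k * ((n ∸ 1) C 2)) - + area (k * (n ∸ 1) + 1) (n ∸ 1) (A ++ B)) ℤ.+ r
theorem4p8 k (suc n) k≥1 _ _ _ A B r _ old@(#E≡ , #N≡ , _) _ _ refl r<m _ =
  trans (cong₂ _-_ (cong +_ (k*[1+n]C2 k n)) area-new)
        (trans ([c+s]-x≡[c-y]+r (+ (k * (n C 2))) (+ (k * n)) L′ L r rotation)
               (cong (λ z → + (k * (n C 2)) - z ℤ.+ r) (sym area-old)))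
  where
  P′ : Path
  P′ = N ∷ B ++ A ++ Ek k
  L′ L : ℤ
  L′ = linearArea k (steps P′)
  L  = linearArea k (steps (A ++ B))
  cut-E : #E A + #E B ≡ k * n + 1
  cut-E = trans (sym (#E-++ A B)) #E≡
  cut-N : #N A + #N B ≡ n
  cut-N = trans (sym (#N-++ A B)) #N≡
  area-old : + area (k * n + 1) n (A ++ B) ≡ L
  area-old = area-kn+1 k n (A ++ B) (ℕ.≤-reflexive #N≡) (aboveLine-InD k n (A ++ B) old)
  area-new : + area (k * suc n + 1) (suc n) P′ ≡ L′
  area-new = area-kn+1 k (suc n) P′ (ℕ.≤-reflexive (trans (#N-rotate k A B) (cong suc #N≡)))
               (aboveLine-rotate k k A B (rank<m⇒bk<a+k k n (#E A) (#N A) k≥1 r<m)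
                  (trans cut-E (cong (λ z → k * z + 1) (sym cut-N))) (aboveLine-InD k n (A ++ B) old))
  rotation : L′ ℤ.+ r ≡ L ℤ.+ + (k * n)
  rotation = begin
    L′ ℤ.+ r                                        ≡⟨ cong (ℤ._+_ L′) (rank-cut A B cut-E cut-N) ⟩
    L′ ℤ.+ (+ #N A ℤ.* + #E B - + #E A ℤ.* + #N B)  ≡⟨ linearArea-rotate k k A B ⟩
    L ℤ.+ + k ℤ.* + (#N A + #N B)                   ≡⟨ cong (λ z → L ℤ.+ + k ℤ.* + z) cut-N ⟩
    L ℤ.+ + k ℤ.* + n                               ≡⟨ cong (ℤ._+_ L) (ℤ.pos-* k n) ⟨
    L ℤ.+ + (k * n)                                 ∎
    where open ≡-Reasoning
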